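{- Let $X$ be a linear tripartite 3-uniform hypergraph whose three parts each have $N$ vertices, such that for any two vertices $u,v$ from different parts there is at most one vertex $w$ in the remaining part such that $\{u,w\}$ is contained in a hyperedge and $\{v,w\}$ is contained in a hyperedge. Then $X$ has at most $N^{3/2}$ hyperedges. Furthermore, when $N$ is a perfect square, the hypergraph $M_{N^{1/2},N^{1/2},N^{1/2}}$ satisfies these hypotheses and has exactly $N^{3/2}$ hyperedges.
   Context: A 3-uniform hypergraph is linear if any two vertices lie in at most one common hyperedge. In a tripartite 3-uniform hypergraph every hyperedge has one vertex in each part. $M_{p,q,r}$ is the tripartite 3-uniform hypergraph with parts $[p]\times[q]$, $[q]\times[r]$, $[r]\times[p]$, where $((i,j),(k,l),(m,n))$ is a hyperedge iff $j=k$, $l=m$, $n=i$. -}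

module Defs where

open import Data.Nat using (ℕ; zero; suc; _+_; _*_)
open import Data.Fin using (Fin; remQuot) renaming (zero to fzero; suc to fsuc)
open import Data.Fin.Properties using (_≟_)
open import Data.Bool using (Bool; true; false; if_then_else_; _∧_)
open import Data.Product using (Σ; _×_; _,_; ∃; ∃-syntax)
open import Relation.Nullary.Decidable using (⌊_⌋)
open import Relation.Binary.PropositionalEquality using (_≡_)

-- A tripartite 3-uniform hypergraph with three parts A, B, C, each a copy of
-- Fin N.  Every hyperedge has exactly one vertex in each part, so a hyperedge
-- is a triple (a , b , c); the (finite) edge set is given by its decidable
-- characteristic function.
Hypergraph : ℕ → Set
Hypergraph N = Fin N → Fin N → Fin N → Bool

sumFin : (n : ℕ) → (Fin n → ℕ) → ℕ
sumFin zero    f = 0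
sumFin (suc n) f = f fzero + sumFin n (λ i → f (fsuc i))

numEdges : {N : ℕ} → Hypergraph N → ℕ
numEdges {N} E =
  sumFin N (λ a → sumFin N (λ b → sumFin N (λ c → if E a b c then 1 else 0)))

-- Linear: any two vertices lie in at most one common hyperedge.
-- (Two distinct vertices in the same part never share a hyperedge, so only
-- pairs from different parts need a condition.)
Linear : {N : ℕ} → Hypergraph N → Set
Linear {N} E =
  (∀ a b c c' → E a b c ≡ true → E a b c' ≡ true → c ≡ c') ×
  (∀ a b b' c → E a b c ≡ true → E a b' c ≡ true → b ≡ b') ×
  (∀ a a' b c → E a b c ≡ true → E a' b c ≡ true → a ≡ a')

AdjAB : {N : ℕ} → Hypergraph N → Fin N → Fin N → Set
AdjAB E a b = ∃[ c ] E a b c ≡ true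

AdjAC : {N : ℕ} → Hypergraph N → Fin N → Fin N → Set
AdjAC E a c = ∃[ b ] E a b c ≡ true

AdjBC : {N : ℕ} → Hypergraph N → Fin N → Fin N → Set
AdjBC E b c = ∃[ a ] E a b c ≡ true

UniqueCommonNeighbour : {N : ℕ} → Hypergraph N → Set
UniqueCommonNeighbour E =
  (∀ a b c c' → AdjAC E a c × AdjBC E b c → AdjAC E a c' × AdjBC E b c' → c ≡ c') ×
  (∀ a c b b' → AdjAB E a b × AdjBC E b c → AdjAB E a b' × AdjBC E b' c → b ≡ b') ×
  (∀ b c a a' → AdjAB E a b × AdjAC E a c → AdjAB E a' b × AdjAC E a' c → a ≡ a')

-- M_{m,m,m}: parts [m]×[m], identified with Fin (m * m) via remQuot
-- (x ↦ (quotient, remainder)).  ((i,j),(k,l),(p,q)) is an edge iff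
-- j = k, l = p, q = i.
M : (m : ℕ) → Hypergraph (m * m)
M m x y z with remQuot m x | remQuot m y | remQuot m z
... | i , j | k , l | p , q = ⌊ j ≟ k ⌋ ∧ (⌊ l ≟ p ⌋ ∧ ⌊ q ≟ i ⌋)

-- Count the edges through the vertices c of the third part: by linearity the
-- edges through c meet the first and second parts in deg c distinct vertices
-- each, giving deg c ² pairs (a , b) with c a common neighbour of a and b.
-- Each pair has at most one common neighbour, so Σ deg c ² ≤ N², and
-- Cauchy–Schwarz turns this into (Σ deg c)² ≤ N³.  In M_{m,m,m} an edge is
-- ((i , j) , (j , l) , (l , i)), so any two of its vertices fix the third.
module Submission where

open import Defs
open import Data.Nat.Properties
  using (+-*-semiring; +-mono-≤; +-monoʳ-≤; *-mono-≤; *-monoʳ-≤; *-cancelˡ-≤; *-comm; *-assoc;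
         *-zeroʳ; *-identityʳ; +-identityʳ; +-assoc; ≮⇒≥; n≤0⇒n≡0; module ≤-Reasoning)
open import Algebra.Properties.Semiring.Sum +-*-semiring
  using (sum; ∑-comm; ∑-distrib-+; *-distribˡ-sum; *-distribʳ-sum)
open import Data.Bool using (Bool; true; false; if_then_else_; _∧_)
open import Data.Bool.Properties using (∧-assoc)
open import Data.Fin using (Fin; _↑ˡ_; _↑ʳ_; combine; remQuot)
  renaming (zero to fzero; suc to fsuc)
open import Data.Fin.Properties using (_≟_; 0≢1+n; suc-injective; combine-remQuot; remQuot-combine)
open import Data.Nat using (ℕ; zero; suc; _+_; _*_; _≤_; _<_; z≤n; s≤s)
open import Data.Nat.Tactic.RingSolver using (solve-∀)
open import Data.Product using (_×_; _,_; proj₁; proj₂; ∃-syntax)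
open import Function using (_∘_)
open import Relation.Nullary using (Dec; yes; no)
open import Relation.Nullary.Decidable using (⌊_⌋; ⌊⌋-map′)
open import Relation.Binary.PropositionalEquality
  using (_≡_; refl; sym; trans; cong; cong₂; subst; subst₂; module ≡-Reasoning)

sumFin≡sum : ∀ n (f : Fin n → ℕ) → sumFin n f ≡ sum f
sumFin≡sum zero    f = refl
sumFin≡sum (suc n) f = cong (f fzero +_) (sumFin≡sum n (f ∘ fsuc))

sumFin-cong : ∀ n {f g : Fin n → ℕ} → (∀ i → f i ≡ g i) → sumFin n f ≡ sumFin n g
sumFin-cong zero    f≡g = refl
sumFin-cong (suc n) f≡g = cong₂ _+_ (f≡g fzero) (sumFin-cong n (f≡g ∘ fsuc))

sumFin-mono-≤ : ∀ n {f g : Fin n → ℕ} → (∀ i → f i ≤ g i) → sumFin n f ≤ sumFin n g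
sumFin-mono-≤ zero    f≤g = z≤n
sumFin-mono-≤ (suc n) f≤g = +-mono-≤ (f≤g fzero) (sumFin-mono-≤ n (f≤g ∘ fsuc))

sumFin-const : ∀ n x → sumFin n (λ _ → x) ≡ n * x
sumFin-const zero    x = refl
sumFin-const (suc n) x = cong (x +_) (sumFin-const n x)

sumFin-zero : ∀ n {f : Fin n → ℕ} → (∀ i → f i ≡ 0) → sumFin n f ≡ 0
sumFin-zero n f≡0 = trans (sumFin-cong n f≡0) (trans (sumFin-const n 0) (*-zeroʳ n))

sumFin-distrib-+ : ∀ n (f g : Fin n → ℕ) →
  sumFin n (λ i → f i + g i) ≡ sumFin n f + sumFin n g
sumFin-distrib-+ n f g = begin
  sumFin n (λ i → f i + g i) ≡⟨ sumFin≡sum n _ ⟩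
  sum (λ i → f i + g i)      ≡⟨ ∑-distrib-+ f g ⟩
  sum f + sum g              ≡⟨ sym (cong₂ _+_ (sumFin≡sum n f) (sumFin≡sum n g)) ⟩
  sumFin n f + sumFin n g    ∎
  where open ≡-Reasoning

*-distribˡ-sumFin : ∀ n x (f : Fin n → ℕ) → x * sumFin n f ≡ sumFin n (λ i → x * f i)
*-distribˡ-sumFin n x f = begin
  x * sumFin n f           ≡⟨ cong (x *_) (sumFin≡sum n f) ⟩
  x * sum f                ≡⟨ *-distribˡ-sum x f ⟩
  sum (λ i → x * f i)      ≡⟨ sym (sumFin≡sum n _) ⟩
  sumFin n (λ i → x * f i) ∎
  where open ≡-Reasoning

*-distribʳ-sumFin : ∀ n x (f : Fin n → ℕ) → sumFin n f * x ≡ sumFin n (λ i → f i * x)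
*-distribʳ-sumFin n x f = begin
  sumFin n f * x           ≡⟨ cong (_* x) (sumFin≡sum n f) ⟩
  sum f * x                ≡⟨ *-distribʳ-sum x f ⟩
  sum (λ i → f i * x)      ≡⟨ sym (sumFin≡sum n _) ⟩
  sumFin n (λ i → f i * x) ∎
  where open ≡-Reasoning

sumFin-comm : ∀ m n (f : Fin m → Fin n → ℕ) →
  sumFin m (λ i → sumFin n (f i)) ≡ sumFin n (λ j → sumFin m (λ i → f i j))
sumFin-comm m n f = begin
  sumFin m (λ i → sumFin n (f i))            ≡⟨ sumFin²≡sum² m n f ⟩
  sum (λ i → sum (f i))                      ≡⟨ ∑-comm f ⟩
  sum (λ j → sum (λ i → f i j))              ≡⟨ sym (sumFin²≡sum² n m (λ j i → f i j)) ⟩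
  sumFin n (λ j → sumFin m (λ i → f i j))    ∎
  where
  open ≡-Reasoning
  sumFin²≡sum² : ∀ m n (g : Fin m → Fin n → ℕ) →
    sumFin m (λ i → sumFin n (g i)) ≡ sum (λ i → sum (g i))
  sumFin²≡sum² m n g =
    trans (sumFin-cong m (λ i → sumFin≡sum n (g i))) (sumFin≡sum m _)

sumFin-* : ∀ m n (f : Fin m → ℕ) (g : Fin n → ℕ) →
  sumFin m f * sumFin n g ≡ sumFin m (λ i → sumFin n (λ j → f i * g j))
sumFin-* m n f g =
  trans (*-distribʳ-sumFin m (sumFin n g) f)
        (sumFin-cong m (λ i → *-distribˡ-sumFin n (f i) g))

sumFin-++ : ∀ m n (f : Fin (m + n) → ℕ) →
  sumFin (m + n) f ≡ sumFin m (λ i → f (i ↑ˡ n)) + sumFin n (λ j → f (m ↑ʳ j))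
sumFin-++ zero    n f = refl
sumFin-++ (suc m) n f =
  trans (cong (f fzero +_) (sumFin-++ m n (f ∘ fsuc))) (sym (+-assoc (f fzero) _ _))

sumFin-combine : ∀ m n (f : Fin (m * n) → ℕ) →
  sumFin (m * n) f ≡ sumFin m (λ i → sumFin n (λ j → f (combine i j)))
sumFin-combine zero    n f = refl
sumFin-combine (suc m) n f =
  trans (sumFin-++ n (m * n) f) (cong (sumFin n (λ j → f (j ↑ˡ (m * n))) +_) (sumFin-combine m n (λ k → f (n ↑ʳ k))))

sumFin≤1 : ∀ n (f : Fin n → ℕ) → (∀ i → f i ≤ 1) →
  (∀ i j → 0 < f i → 0 < f j → i ≡ j) → sumFin n f ≤ 1
sumFin≤1 zero    f f≤1 unique = z≤n
sumFin≤1 (suc n) f f≤1 unique with f fzero in eq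
... | zero  = sumFin≤1 n (f ∘ fsuc) (f≤1 ∘ fsuc)
                (λ i j p q → suc-injective (unique (fsuc i) (fsuc j) p q))
... | suc k = begin
  suc k + sumFin n (f ∘ fsuc) ≡⟨ cong (suc k +_) (sumFin-zero n tail≡0) ⟩
  suc k + 0                   ≡⟨ +-identityʳ (suc k) ⟩
  suc k                       ≡⟨ sym eq ⟩
  f fzero                     ≤⟨ f≤1 fzero ⟩
  1                           ∎
  where
  open ≤-Reasoning
  tail≡0 : ∀ i → f (fsuc i) ≡ 0
  tail≡0 i = n≤0⇒n≡0 (≮⇒≥ λ pos → 0≢1+n (unique fzero (fsuc i) (subst (0 <_) (sym eq) (s≤s z≤n)) pos))

2mn≤m²+n² : ∀ m n → 2 * (m * n) ≤ m * m + n * n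
2mn≤m²+n² zero    n       = z≤n
2mn≤m²+n² (suc m) zero    rewrite *-zeroʳ (suc m) = z≤n
2mn≤m²+n² (suc m) (suc n) =
  subst₂ _≤_ (lhs m n) (rhs m n) (+-monoʳ-≤ (2 + 2 * m + 2 * n) (2mn≤m²+n² m n))
  where
  lhs : ∀ m n → 2 + 2 * m + 2 * n + 2 * (m * n) ≡ 2 * (suc m * suc n)
  lhs = solve-∀
  rhs : ∀ m n → 2 + 2 * m + 2 * n + (m * m + n * n) ≡ suc m * suc m + suc n * suc n
  rhs = solve-∀

m*n>0⇒m>0 : ∀ m {n} → 0 < m * n → 0 < m
m*n>0⇒m>0 (suc m) _ = s≤s z≤n

sumFin-cauchy-schwarz : ∀ n (d : Fin n → ℕ) →
  sumFin n d * sumFin n d ≤ n * sumFin n (λ i → d i * d i)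
sumFin-cauchy-schwarz n d = *-cancelˡ-≤ 2 (begin
  2 * (sumFin n d * sumFin n d)                            ≡⟨ cong (2 *_) (sumFin-* n n d d) ⟩
  2 * sumFin n (λ i → sumFin n (λ j → d i * d j))          ≡⟨ *-distribˡ-sumFin n 2 _ ⟩
  sumFin n (λ i → 2 * sumFin n (λ j → d i * d j))          ≡⟨ sumFin-cong n (λ i → *-distribˡ-sumFin n 2 _) ⟩
  sumFin n (λ i → sumFin n (λ j → 2 * (d i * d j)))        ≤⟨ sumFin-mono-≤ n (λ i → sumFin-mono-≤ n (λ j → 2mn≤m²+n² (d i) (d j))) ⟩
  sumFin n (λ i → sumFin n (λ j → d i * d i + d j * d j))  ≡⟨ sumFin-cong n (λ i → sumFin-distrib-+ n _ _) ⟩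
  sumFin n (λ i → sumFin n (λ _ → d i * d i) + Q)          ≡⟨ sumFin-distrib-+ n _ _ ⟩
  sumFin n (λ i → sumFin n (λ _ → d i * d i)) + sumFin n (λ _ → Q)
    ≡⟨ cong (_+ sumFin n (λ _ → Q)) (sumFin-comm n n (λ i _ → d i * d i)) ⟩
  sumFin n (λ _ → Q) + sumFin n (λ _ → Q)                  ≡⟨ cong (λ x → x + x) (sumFin-const n Q) ⟩
  n * Q + n * Q                                            ≡⟨ cong (n * Q +_) (sym (+-identityʳ (n * Q))) ⟩
  2 * (n * Q)                                              ∎)
  where
  open ≤-Reasoning
  Q = sumFin n (λ i → d i * d i)

𝟙 : Bool → ℕ
𝟙 b = if b then 1 else 0

𝟙≤1 : ∀ b → 𝟙 b ≤ 1
𝟙≤1 true  = s≤s z≤n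
𝟙≤1 false = z≤n

𝟙-pos : ∀ {b} → 0 < 𝟙 b → b ≡ true
𝟙-pos {true} _ = refl

sumFin-𝟙-pos : ∀ n (g : Fin n → Bool) → 0 < sumFin n (𝟙 ∘ g) → ∃[ i ] g i ≡ true
sumFin-𝟙-pos (suc n) g pos with g fzero in eq
... | true  = fzero , eq
... | false with sumFin-𝟙-pos n (g ∘ fsuc) pos
...   | i , gi≡true = fsuc i , gi≡true

sumFin-𝟙-∧-≡ˡ : ∀ {n} b (i : Fin n) → sumFin n (λ j → 𝟙 (b ∧ ⌊ j ≟ i ⌋)) ≡ 𝟙 b
sumFin-𝟙-∧-≡ˡ {n}     false i        = sumFin-zero n (λ _ → refl)
sumFin-𝟙-∧-≡ˡ {suc n} true  fzero    = cong suc (sumFin-zero n (λ _ → refl))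
sumFin-𝟙-∧-≡ˡ {suc n} true  (fsuc i) =
  trans (sumFin-cong n (λ j → cong 𝟙 (⌊⌋-map′ _ _ (j ≟ i)))) (sumFin-𝟙-∧-≡ˡ true i)

sumFin-𝟙-∧-≡ʳ : ∀ {n} b (i : Fin n) → sumFin n (λ j → 𝟙 (b ∧ ⌊ i ≟ j ⌋)) ≡ 𝟙 b
sumFin-𝟙-∧-≡ʳ {n}     false i        = sumFin-zero n (λ _ → refl)
sumFin-𝟙-∧-≡ʳ {suc n} true  fzero    = cong suc (sumFin-zero n (λ _ → refl))
sumFin-𝟙-∧-≡ʳ {suc n} true  (fsuc i) =
  trans (sumFin-cong n (λ j → cong 𝟙 (⌊⌋-map′ _ _ (i ≟ j)))) (sumFin-𝟙-∧-≡ʳ true i)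

module _ {N : ℕ} (E : Hypergraph N) where

  codegreeAC : Fin N → Fin N → ℕ
  codegreeAC a c = sumFin N (λ b → 𝟙 (E a b c))

  codegreeBC : Fin N → Fin N → ℕ
  codegreeBC b c = sumFin N (λ a → 𝟙 (E a b c))

  degreeC : Fin N → ℕ
  degreeC c = sumFin N (λ a → codegreeAC a c)

  numEdges≡sum-degreeC : numEdges E ≡ sumFin N degreeC
  numEdges≡sum-degreeC =
    trans (sumFin-cong N (λ a → sumFin-comm N N (λ b c → 𝟙 (E a b c))))
          (sumFin-comm N N codegreeAC)

  degreeC²≡sum-codegree : ∀ c →
    degreeC c * degreeC c ≡ sumFin N (λ a → sumFin N (λ b → codegreeAC a c * codegreeBC b c))
  degreeC²≡sum-codegree c = begin
    degreeC c * degreeC c                       ≡⟨ cong (degreeC c *_) (sumFin-comm N N (λ a b → 𝟙 (E a b c))) ⟩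
    degreeC c * sumFin N (λ b → codegreeBC b c) ≡⟨ sumFin-* N N _ _ ⟩
    sumFin N (λ a → sumFin N (λ b → codegreeAC a c * codegreeBC b c)) ∎
    where open ≡-Reasoning

  codegreeAC-pos⇒AdjAC : ∀ a c → 0 < codegreeAC a c → AdjAC E a c
  codegreeAC-pos⇒AdjAC a c = sumFin-𝟙-pos N (λ b → E a b c)

  codegreeBC-pos⇒AdjBC : ∀ b c → 0 < codegreeBC b c → AdjBC E b c
  codegreeBC-pos⇒AdjBC b c = sumFin-𝟙-pos N (λ a → E a b c)

  module _ (linear : Linear E) where

    codegreeAC≤1 : ∀ a c → codegreeAC a c ≤ 1
    codegreeAC≤1 a c = sumFin≤1 N _ (λ b → 𝟙≤1 (E a b c))
      (λ b b' p q → proj₁ (proj₂ linear) a b b' c (𝟙-pos p) (𝟙-pos q))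

    codegreeBC≤1 : ∀ b c → codegreeBC b c ≤ 1
    codegreeBC≤1 b c = sumFin≤1 N _ (λ a → 𝟙≤1 (E a b c))
      (λ a a' p q → proj₂ (proj₂ linear) a a' b c (𝟙-pos p) (𝟙-pos q))

    module _ (unique : UniqueCommonNeighbour E) where

      commonNeighboursC≤1 : ∀ a b → sumFin N (λ c → codegreeAC a c * codegreeBC b c) ≤ 1
      commonNeighboursC≤1 a b = sumFin≤1 N _
        (λ c → *-mono-≤ (codegreeAC≤1 a c) (codegreeBC≤1 b c))
        (λ c c' p q → proj₁ unique a b c c' (adjacent c p) (adjacent c' q))
        where
        adjacent : ∀ c → 0 < codegreeAC a c * codegreeBC b c → AdjAC E a c × AdjBC E b c
        adjacent c pos =
            codegreeAC-pos⇒AdjAC a c (m*n>0⇒m>0 (codegreeAC a c) pos)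
          , codegreeBC-pos⇒AdjBC b c (m*n>0⇒m>0 (codegreeBC b c) (subst (0 <_) (*-comm (codegreeAC a c) _) pos))

      sum-degreeC²≤N² : sumFin N (λ c → degreeC c * degreeC c) ≤ N * N
      sum-degreeC²≤N² = begin
        sumFin N (λ c → degreeC c * degreeC c)
          ≡⟨ sumFin-cong N degreeC²≡sum-codegree ⟩
        sumFin N (λ c → sumFin N (λ a → sumFin N (λ b → codegreeAC a c * codegreeBC b c)))
          ≡⟨ sumFin-comm N N _ ⟩
        sumFin N (λ a → sumFin N (λ c → sumFin N (λ b → codegreeAC a c * codegreeBC b c)))
          ≡⟨ sumFin-cong N (λ a → sumFin-comm N N _) ⟩
        sumFin N (λ a → sumFin N (λ b → sumFin N (λ c → codegreeAC a c * codegreeBC b c)))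
          ≤⟨ sumFin-mono-≤ N (λ a → sumFin-mono-≤ N (commonNeighboursC≤1 a)) ⟩
        sumFin N (λ _ → sumFin N (λ _ → 1))
          ≡⟨ trans (sumFin-cong N (λ _ → trans (sumFin-const N 1) (*-identityʳ N))) (sumFin-const N N) ⟩
        N * N ∎
        where open ≤-Reasoning

      numEdges²≤N³ : numEdges E * numEdges E ≤ N * N * N
      numEdges²≤N³ = begin
        numEdges E * numEdges E                    ≡⟨ cong (λ e → e * e) numEdges≡sum-degreeC ⟩
        sumFin N degreeC * sumFin N degreeC        ≤⟨ sumFin-cauchy-schwarz N degreeC ⟩
        N * sumFin N (λ c → degreeC c * degreeC c) ≤⟨ *-monoʳ-≤ N sum-degreeC²≤N² ⟩
        N * (N * N)                                ≡⟨ sym (*-assoc N N N) ⟩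
        N * N * N                                  ∎
        where open ≤-Reasoning

UniqueCommonNeighbour⇒Linear : ∀ {N} {E : Hypergraph N} → UniqueCommonNeighbour E → Linear E
UniqueCommonNeighbour⇒Linear (uniqueC , uniqueB , uniqueA) =
    (λ a b c c' e e' → uniqueC a b c c' ((b , e) , (a , e)) ((b , e') , (a , e')))
  , (λ a b b' c e e' → uniqueB a c b b' ((c , e) , (a , e)) ((c , e') , (a , e')))
  , (λ a a' b c e e' → uniqueA b c a a' ((c , e) , (b , e)) ((c , e') , (b , e')))

module _ (m : ℕ) where

  quot rem : Fin (m * m) → Fin m
  quot x = proj₁ (remQuot {m} m x)
  rem  x = proj₂ (remQuot {m} m x)

  quot-rem-injective : ∀ x y → quot x ≡ quot y → rem x ≡ rem y → x ≡ y
  quot-rem-injective x y q≡ r≡ =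
    trans (sym (combine-remQuot {m} m x)) (trans (cong₂ combine q≡ r≡) (combine-remQuot {m} m y))

  M-edge : ∀ x y z → M m x y z ≡ true → rem x ≡ quot y × rem y ≡ quot z × rem z ≡ quot x
  M-edge x y z = toWitness³ (rem x ≟ quot y) (rem y ≟ quot z) (rem z ≟ quot x)
    where
    toWitness³ : ∀ {A B C : Set} (a? : Dec A) (b? : Dec B) (c? : Dec C) →
      ⌊ a? ⌋ ∧ (⌊ b? ⌋ ∧ ⌊ c? ⌋) ≡ true → A × B × C
    toWitness³ (yes a) (yes b) (yes c) _ = a , b , c
    toWitness³ (yes _) (yes _) (no _) ()
    toWitness³ (yes _) (no _)  _      ()
    toWitness³ (no _)  _       _      ()

  M-adjAB : ∀ x y → AdjAB (M m) x y → rem x ≡ quot y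
  M-adjAB x y (z , e) = proj₁ (M-edge x y z e)

  M-adjBC : ∀ y z → AdjBC (M m) y z → rem y ≡ quot z
  M-adjBC y z (x , e) = proj₁ (proj₂ (M-edge x y z e))

  M-adjAC : ∀ x z → AdjAC (M m) x z → rem z ≡ quot x
  M-adjAC x z (y , e) = proj₂ (proj₂ (M-edge x y z e))

  M-uniqueCommonNeighbour : UniqueCommonNeighbour (M m)
  M-uniqueCommonNeighbour =
      (λ a b c c' (ac , bc) (ac' , bc') → quot-rem-injective c c'
          (trans (sym (M-adjBC b c bc)) (M-adjBC b c' bc'))
          (trans (M-adjAC a c ac) (sym (M-adjAC a c' ac'))))
    , (λ a c b b' (ab , bc) (ab' , bc') → quot-rem-injective b b'
          (trans (sym (M-adjAB a b ab)) (M-adjAB a b' ab'))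
          (trans (M-adjBC b c bc) (sym (M-adjBC b' c bc'))))
    , (λ b c a a' (ab , ac) (ab' , ac') → quot-rem-injective a a'
          (trans (sym (M-adjAC a c ac)) (M-adjAC a' c ac'))
          (trans (M-adjAB a b ab) (sym (M-adjAB a' b ab'))))

  M-combine : ∀ (i j k l p w : Fin m) →
    M m (combine i j) (combine k l) (combine p w) ≡ (⌊ j ≟ k ⌋ ∧ (⌊ l ≟ p ⌋ ∧ ⌊ w ≟ i ⌋))
  M-combine i j k l p w =
    cong₂ (λ x (y , z) → M-condition x y z)
          (remQuot-combine {m} {m} i j)
          (cong₂ _,_ (remQuot-combine {m} {m} k l) (remQuot-combine {m} {m} p w))
    where
    M-condition : Fin m × Fin m → Fin m × Fin m → Fin m × Fin m → Bool
    M-condition (i , j) (k , l) (p , w) = ⌊ j ≟ k ⌋ ∧ (⌊ l ≟ p ⌋ ∧ ⌊ w ≟ i ⌋)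

  M-degreeA : ∀ i j → sumFin (m * m) (λ y → sumFin (m * m) (λ z → 𝟙 (M m (combine i j) y z))) ≡ m
  M-degreeA i j = begin
    sumFin (m * m) (λ y → sumFin (m * m) (λ z → 𝟙 (M m (combine i j) y z)))
      ≡⟨ sumFin-combine m m _ ⟩
    sumFin m (λ k → sumFin m (λ l → sumFin (m * m) (λ z → 𝟙 (M m (combine i j) (combine k l) z))))
      ≡⟨ sumFin-cong m (λ k → sumFin-cong m (λ l → trans (sumFin-combine m m _) (codegreeAB k l))) ⟩
    sumFin m (λ k → sumFin m (λ _ → 𝟙 ⌊ j ≟ k ⌋))
      ≡⟨ sumFin-comm m m _ ⟩
    sumFin m (λ _ → sumFin m (λ k → 𝟙 ⌊ j ≟ k ⌋))
      ≡⟨ trans (sumFin-cong m (λ _ → sumFin-𝟙-∧-≡ʳ true j)) (trans (sumFin-const m 1) (*-identityʳ m)) ⟩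
    m ∎
    where
    open ≡-Reasoning
    codegreeAB : ∀ k l →
      sumFin m (λ p → sumFin m (λ w → 𝟙 (M m (combine i j) (combine k l) (combine p w)))) ≡ 𝟙 ⌊ j ≟ k ⌋
    codegreeAB k l = begin
      sumFin m (λ p → sumFin m (λ w → 𝟙 (M m (combine i j) (combine k l) (combine p w))))
        ≡⟨ sumFin-cong m (λ p → sumFin-cong m (λ w →
             cong 𝟙 (trans (M-combine i j k l p w) (sym (∧-assoc ⌊ j ≟ k ⌋ ⌊ l ≟ p ⌋ ⌊ w ≟ i ⌋))))) ⟩
      sumFin m (λ p → sumFin m (λ w → 𝟙 ((⌊ j ≟ k ⌋ ∧ ⌊ l ≟ p ⌋) ∧ ⌊ w ≟ i ⌋)))
        ≡⟨ sumFin-cong m (λ p → sumFin-𝟙-∧-≡ˡ (⌊ j ≟ k ⌋ ∧ ⌊ l ≟ p ⌋) i) ⟩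
      sumFin m (λ p → 𝟙 (⌊ j ≟ k ⌋ ∧ ⌊ l ≟ p ⌋))
        ≡⟨ sumFin-𝟙-∧-≡ʳ ⌊ j ≟ k ⌋ l ⟩
      𝟙 ⌊ j ≟ k ⌋ ∎

  M-numEdges : numEdges (M m) ≡ m * m * m
  M-numEdges = begin
    numEdges (M m)
      ≡⟨ sumFin-combine m m _ ⟩
    sumFin m (λ i → sumFin m (λ j → sumFin (m * m) (λ y → sumFin (m * m) (λ z → 𝟙 (M m (combine i j) y z)))))
      ≡⟨ sumFin-cong m (λ i → sumFin-cong m (M-degreeA i)) ⟩
    sumFin m (λ _ → sumFin m (λ _ → m))
      ≡⟨ trans (sumFin-cong m (λ _ → sumFin-const m m)) (sumFin-const m (m * m)) ⟩
    m * (m * m)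
      ≡⟨ sym (*-assoc m m m) ⟩
    m * m * m ∎
    where open ≡-Reasoning

proposition3p1 :
    ((N : ℕ) → (E : Hypergraph N) → Linear E → UniqueCommonNeighbour E →
      numEdges E * numEdges E ≤ N * N * N)
    ×
    ((m : ℕ) → Linear (M m) × UniqueCommonNeighbour (M m) × numEdges (M m) ≡ m * m * m)
proposition3p1 =
    (λ N E → numEdges²≤N³ E)
  , λ m → UniqueCommonNeighbour⇒Linear (M-uniqueCommonNeighbour m)
        , M-uniqueCommonNeighbour m
        , M-numEdges m
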